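{- There exists an $n$-vertex graph $G=(V,E)$ with maximum degree $\Delta = 0.5\sqrt{\log n}$ such that if for each vertex $v \in V$ we independently pick a set $L(v)$ of $\ell = 0.5\sqrt{\log n}$ colors uniformly at random from $2\Delta$ colors, then with probability $1-o(1)$ there is no proper coloring of $G$ in which every vertex $v$ receives a color from $L(v)$.
   Context: A proper coloring assigns colors so that adjacent vertices get distinct colors; $o(1)$ is with respect to $n \to \infty$. -}

module Defs where

open import Data.Nat as ℕ using (ℕ; zero; suc; _^_; _!; _≤_; _*_)
open import Data.Nat.Properties using (_!≢0)
open import Data.Integer as ℤ using (+_)
open import Data.Rational.Unnormalised as ℚᵘ using (ℚᵘ; 0ℚᵘ)
open import Data.Bool using (Bool; true; false; if_then_else_)
open import Data.Fin using (Fin)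
open import Data.Fin.Subset using (Subset; _∈_; ∣_∣)
open import Data.Vec using (Vec; lookup)
open import Data.List using (List; map; allFin; length)
open import Data.Nat.ListAction using (sum)
open import Data.List.Relation.Unary.All using (All)
open import Data.List.Relation.Unary.Unique.Propositional using (Unique)
open import Data.Nat.Combinatorics using (_C_)
open import Data.Product using (Σ; ∃; _×_)
open import Relation.Binary.PropositionalEquality using (_≡_; _≢_)
open import Relation.Nullary using (¬_)

-- e^k compared with a natural number, via partial sums of the
-- exponential series  e^k = Σ_{j ≥ 0} k^j / j!  (all terms ≥ 0).

expPartial : ℕ → ℕ → ℚᵘ
expPartial k zero    = ℚᵘ._/_ (+ 1) 1
expPartial k (suc m) =
  let instance _ = (suc m) !≢0 in
  expPartial k m ℚᵘ.+ ℚᵘ._/_ (+ (k ^ suc m)) ((suc m) !)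

-- e^k ≤ n  (as real numbers)  iff every partial sum is ≤ n
ExpLe : ℕ → ℕ → Set
ExpLe k n = ∀ m → expPartial k m ℚᵘ.≤ ℚᵘ._/_ (+ n) 1

-- Δ = ⌊ 0.5 √(ln n) ⌋, i.e.  4Δ² ≤ ln n < 4(Δ+1)²,
-- i.e.  e^{4Δ²} ≤ n  and not  e^{4(Δ+1)²} ≤ n.
IsHalfSqrtLog : ℕ → ℕ → Set
IsHalfSqrtLog n Δ = ExpLe (4 * (Δ * Δ)) n × ¬ ExpLe (4 * (suc Δ * suc Δ)) n

record Graph (n : ℕ) : Set where
  field
    adj   : Fin n → Fin n → Bool
    sym   : ∀ u v → adj u v ≡ adj v u
    irref : ∀ v → adj v v ≡ false
open Graph public

degree : ∀ {n} → Graph n → Fin n → ℕ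
degree {n} G v = sum (map (λ u → if adj G v u then 1 else 0) (allFin n))

MaxDegree : ∀ {n} → Graph n → ℕ → Set
MaxDegree {n} G d = (∀ v → degree G v ≤ d) × ∃ λ v → degree G v ≡ d

ListAssignment : ℕ → ℕ → Set
ListAssignment n k = Vec (Subset k) n

HasListSize : ∀ {n k} → ℕ → ListAssignment n k → Set
HasListSize {n} ℓ L = ∀ (v : Fin n) → ∣ lookup L v ∣ ≡ ℓ

IsProperLColoring : ∀ {n k} → Graph n → ListAssignment n k → (Fin n → Fin k) → Set
IsProperLColoring G L c =
  (∀ v → c v ∈ lookup L v) × (∀ u v → adj G u v ≡ true → c u ≢ c v)

LColorable : ∀ {n k} → Graph n → ListAssignment n k → Set
LColorable {n} {k} G L = ∃ λ (c : Fin n → Fin k) → IsProperLColoring G L c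

-- "With probability ≥ 1 - 1/(m+1), a uniformly random assignment of
-- ℓ-subsets of [k] (independently per vertex) is NOT L-colourable":
-- there are at least (1 - 1/(m+1)) · (k choose ℓ)^n distinct bad
-- assignments, i.e.  (m+1)·#bad ≥ m·(k choose ℓ)^n.

BadProbAtLeast : ∀ {n} → Graph n → (k ℓ m : ℕ) → Set
BadProbAtLeast {n} G k ℓ m =
  Σ (List (ListAssignment n k)) λ bad →
    Unique bad ×
    All (λ L → HasListSize ℓ L × ¬ LColorable G L) bad ×
    m * ((k C ℓ) ^ n) ≤ suc m * length bad

module Submission where

-- The graph is a disjoint union of K = ⌊n/(Δ+1)⌋ cliques K_{Δ+1} (plus
-- isolated vertices), so its maximum degree is Δ.  Each list L(v) is a
-- Δ-subset of 2Δ colours, chosen among c = (2Δ choose Δ) ≤ 4^Δ subsets.  If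
-- all Δ + 1 vertices of some clique receive the same list, the clique cannot
-- be coloured (pigeonhole).  Per clique this fails to happen in
-- F = c^(Δ+1) - c of the c^(Δ+1) cases, so the good assignments number
-- F^K c^s, and Bernoulli's inequality (1 - x)^K (1 + Kx) ≤ 1 shows that they
-- form at most a 1/(m+1) fraction as soon as K ≥ m c^Δ.  Since n ≥ e^(4Δ²),
-- comparison with one term of the exponential series gives K ≥ m 4^(Δ²) for
-- large n.

open import Defs hiding (sym)
open import Data.Nat using (ℕ; zero; suc; _+_; _*_; _^_; _!; _≤_; _<_; _<?_; z≤n; s≤s; >-nonZero; NonZero)
open import Data.Integer as ℤ using () renaming (+_ to +ℤ_)
open import Data.Integer.Properties using (drop‿+≤+; pos-*)
open import Data.Rational.Unnormalised as ℚᵘ using (ℚᵘ; 0ℚᵘ; *≤*)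
import Data.Rational.Unnormalised.Properties as ℚᵘP
open import Data.Nat.Properties
open import Data.Nat.DivMod using (_/_; _%_; m≡m%n+[m/n]*n; m*n/n≡m; /-monoˡ-≤)
open import Data.Nat.ListAction using (sum)
open import Data.Nat.Tactic.RingSolver using (solve-∀)
open import Data.Nat.Combinatorics using (_C_; nCk+nC[k+1]≡[n+1]C[k+1])
import Data.Bool as Bool
open import Data.Bool using (Bool; true; false; if_then_else_; not)
open import Data.List as List using (List; []; _∷_; _++_; map; length; concat; [_])
open import Data.List.Properties using (length-++; length-map; map-tabulate; map-cong)
open import Data.List.Membership.Propositional using (_∈_)
open import Data.List.Membership.Propositional.Properties using (∈-map⁺; ∈-map⁻; ∈-concat⁺′)
open import Data.List.Relation.Unary.All as All using (All; []; _∷_)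
import Data.List.Relation.Unary.All.Properties as AllP
open import Data.List.Relation.Unary.Any using (here; there)
open import Data.List.Relation.Unary.AllPairs as AllPairs using ([]; _∷_)
import Data.List.Relation.Unary.AllPairs.Properties as AllPairsP
open import Data.List.Relation.Unary.Unique.Propositional using (Unique)
import Data.List.Relation.Unary.Unique.Propositional.Properties as UniqueP
open import Data.Vec as Vec using (Vec; replicate) renaming (_++_ to _++ᵛ_; [] to []ᵛ; _∷_ to _∷ᵛ_)
open import Data.Vec.Properties using (lookup-++ˡ; lookup-++ʳ; ++-injectiveˡ; ++-injectiveʳ; ∷-injectiveˡ; ∷-injectiveʳ; ≡-dec; lookup-replicate)
import Data.Vec.Relation.Unary.All as VecAll
import Data.Vec.Relation.Unary.All.Properties as VecAllP
open import Data.Fin as Fin using (Fin; _↑ˡ_; _↑ʳ_; splitAt)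
open import Data.Fin.Properties using (splitAt-↑ˡ; splitAt-↑ʳ; splitAt⁻¹-↑ˡ; splitAt⁻¹-↑ʳ)
  renaming (_≟_ to _≟ᶠ_; suc-injective to Fin-suc-injective)
open import Data.Fin.Subset.Properties using (x∈p∧x≢y⇒x∈p-y; x∈p⇒∣p-x∣<∣p∣)
open import Data.Sum using (_⊎_; inj₁; inj₂)
open import Data.Fin.Subset using (Subset; ∣_∣; _-_) renaming (_∈_ to _∈ˢ_)
open import Data.Product using (Σ; ∃; _×_; _,_; proj₁)
open import Data.Empty using (⊥-elim)
open import Relation.Nullary using (yes; no; does; ¬_)
open import Relation.Binary.Definitions using (DecidableEquality)
open import Relation.Binary.PropositionalEquality
  using (_≡_; _≢_; refl; sym; trans; cong; cong₂; subst; subst₂; module ≡-Reasoning)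

count : {A : Set} → (A → Bool) → List A → ℕ
count p []       = 0
count p (x ∷ xs) = if p x then suc (count p xs) else count p xs

count+count-not : {A : Set} (p : A → Bool) (xs : List A) →
                  count p xs + count (λ x → not (p x)) xs ≡ length xs
count+count-not p [] = refl
count+count-not p (x ∷ xs) with p x
... | true  = cong suc (count+count-not p xs)
... | false = trans (+-suc (count p xs) _) (cong suc (count+count-not p xs))

count-++ : {A : Set} (p : A → Bool) (xs ys : List A) →
           count p (xs ++ ys) ≡ count p xs + count p ys
count-++ p [] ys = refl
count-++ p (x ∷ xs) ys with p x
... | true  = cong suc (count-++ p xs ys)
... | false = count-++ p xs ys

count-map : {A B : Set} (p : B → Bool) (f : A → B) (xs : List A) →
            count p (map f xs) ≡ count (λ x → p (f x)) xs
count-map p f [] = refl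
count-map p f (x ∷ xs) with p (f x)
... | true  = cong suc (count-map p f xs)
... | false = count-map p f xs

count-≡-member : {A : Set} (_≟_ : DecidableEquality A) {v : A} {xs : List A} →
                 Unique xs → v ∈ xs → count (λ x → does (x ≟ v)) xs ≡ 1
count-≡-member _≟_ {v} {x ∷ xs} (x∉xs ∷ xs-unique) v∈ with x ≟ v
count-≡-member _≟_ {v} {x ∷ xs} (x∉xs ∷ xs-unique) v∈ | yes refl =
  cong suc (absent xs (All.map (λ x≢y y≡x → x≢y (sym y≡x)) x∉xs))
  where
  absent : ∀ ys → All (_≢ v) ys → count (λ y → does (y ≟ v)) ys ≡ 0
  absent []       []               = refl
  absent (y ∷ ys) (y≢v ∷ ys≢v) with y ≟ v
  ... | yes y≡v = ⊥-elim (y≢v y≡v)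
  ... | no  _   = absent ys ys≢v
count-≡-member _≟_ (x∉xs ∷ xs-unique) (here refl)  | no x≢v = ⊥-elim (x≢v refl)
count-≡-member _≟_ (x∉xs ∷ xs-unique) (there v∈xs) | no x≢v = count-≡-member _≟_ xs-unique v∈xs

sum-constant : {A : Set} (f : A → ℕ) (c : ℕ) {xs : List A} →
               All (λ x → f x ≡ c) xs → sum (map f xs) ≡ length xs * c
sum-constant f c []           = refl
sum-constant f c (fx≡c ∷ all) = cong₂ _+_ fx≡c (sum-constant f c all)

sum-if : {A : Set} (p : A → Bool) (a b : ℕ) (xs : List A) →
         sum (map (λ x → if p x then a else b) xs) ≡ count p xs * a + count (λ x → not (p x)) xs * b
sum-if p a b [] = refl
sum-if p a b (x ∷ xs) with p x
... | true  = trans (cong (a +_) (sum-if p a b xs)) (sym (+-assoc a _ _))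
... | false = trans (cong (b +_) (sum-if p a b xs)) (x+[y+z]≡y+[x+z] b (count p xs * a) _)
  where
  x+[y+z]≡y+[x+z] : ∀ x y z → x + (y + z) ≡ y + (x + z)
  x+[y+z]≡y+[x+z] = solve-∀

prefixed : {A : Set} {a b : ℕ} → List (Vec A a) → (Vec A a → List (Vec A b)) → List (Vec A (a + b))
prefixed us ws = concat (map (λ u → map (u ++ᵛ_) (ws u)) us)

length-prefixed : {A : Set} {a b : ℕ} (us : List (Vec A a)) (ws : Vec A a → List (Vec A b)) →
                  length (prefixed us ws) ≡ sum (map (λ u → length (ws u)) us)
length-prefixed [] ws = refl
length-prefixed (u ∷ us) ws =
  trans (length-++ (map (u ++ᵛ_) (ws u)))
        (cong₂ _+_ (length-map (u ++ᵛ_) (ws u)) (length-prefixed us ws))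

count-prefixed : {A : Set} {a b : ℕ} (p : Vec A (a + b) → Bool)
                 (us : List (Vec A a)) (ws : Vec A a → List (Vec A b)) →
                 count p (prefixed us ws) ≡ sum (map (λ u → count (λ w → p (u ++ᵛ w)) (ws u)) us)
count-prefixed p [] ws = refl
count-prefixed p (u ∷ us) ws =
  trans (count-++ p (map (u ++ᵛ_) (ws u)) _)
        (cong₂ _+_ (count-map p (u ++ᵛ_) (ws u)) (count-prefixed p us ws))

prefixed-unique : {A : Set} {a b : ℕ} {us : List (Vec A a)} (ws : Vec A a → List (Vec A b)) →
                  Unique us → (∀ u → Unique (ws u)) → Unique (prefixed us ws)
prefixed-unique {us = us} ws us-unique ws-unique =
  UniqueP.concat⁺ (AllP.map⁺ (All.universal (λ u → UniqueP.map⁺ (++-injectiveʳ u u) (ws-unique u)) us))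
                  (AllPairsP.map⁺ (AllPairs.map disjoint us-unique))
  where
  disjoint : ∀ {u u′} → u ≢ u′ → ∀ {v} → ¬ (v ∈ map (u ++ᵛ_) (ws u) × v ∈ map (u′ ++ᵛ_) (ws u′))
  disjoint u≢u′ (v∈ , v∈′) with ∈-map⁻ _ v∈ | ∈-map⁻ _ v∈′
  ... | _ , _ , v≡ | _ , _ , v≡′ = u≢u′ (++-injectiveˡ _ _ (trans (sym v≡) v≡′))

prefixed-all : {A : Set} {a b : ℕ} {P : Vec A (a + b) → Set} {us : List (Vec A a)} (ws : Vec A a → List (Vec A b)) →
               (∀ {u} → u ∈ us → All (λ w → P (u ++ᵛ w)) (ws u)) → All P (prefixed us ws)
prefixed-all ws h = AllP.concat⁺ (AllP.map⁺ (All.tabulate (λ u∈us → AllP.map⁺ (h u∈us))))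

∈-prefixed : {A : Set} {a b : ℕ} {us : List (Vec A a)} (ws : Vec A a → List (Vec A b)) {u : Vec A a} {w : Vec A b} →
             u ∈ us → w ∈ ws u → u ++ᵛ w ∈ prefixed us ws
∈-prefixed ws u∈us w∈ws = ∈-concat⁺′ (∈-map⁺ _ w∈ws) (∈-map⁺ (λ u → map (u ++ᵛ_) (ws u)) u∈us)

vectors : {A : Set} → List A → (n : ℕ) → List (Vec A n)
vectors S zero    = [ []ᵛ ]
vectors S (suc n) = prefixed (map (_∷ᵛ []ᵛ) S) (λ _ → vectors S n)

length-vectors : {A : Set} (S : List A) (n : ℕ) → length (vectors S n) ≡ length S ^ n
length-vectors S zero = refl
length-vectors S (suc n) = begin
    length (vectors S (suc n))
  ≡⟨ length-prefixed (map (_∷ᵛ []ᵛ) S) (λ _ → vectors S n) ⟩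
    sum (map (λ _ → length (vectors S n)) (map (_∷ᵛ []ᵛ) S))
  ≡⟨ sum-constant _ _ (All.universal (λ _ → refl) (map (_∷ᵛ []ᵛ) S)) ⟩
    length (map (_∷ᵛ []ᵛ) S) * length (vectors S n)
  ≡⟨ cong₂ _*_ (length-map (_∷ᵛ []ᵛ) S) (length-vectors S n) ⟩
    length S ^ suc n ∎
  where open ≡-Reasoning

vectors-unique : {A : Set} {S : List A} → Unique S → ∀ n → Unique (vectors S n)
vectors-unique S-unique zero    = [] ∷ []
vectors-unique S-unique (suc n) =
  prefixed-unique (λ _ → vectors _ n) (UniqueP.map⁺ ∷-injectiveˡ S-unique) (λ _ → vectors-unique S-unique n)

vectors-all : {A : Set} {P : A → Set} {S : List A} → All P S → ∀ n → All (VecAll.All P) (vectors S n)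
vectors-all S-all zero    = VecAll.[] ∷ []
vectors-all S-all (suc n) = prefixed-all (λ _ → vectors _ n) (λ u∈ →
  let (x , x∈S , u≡) = ∈-map⁻ _ u∈ in
  subst (λ u → All (λ w → VecAll.All _ (u ++ᵛ w)) (vectors _ n)) (sym u≡)
        (All.map (All.lookup S-all x∈S VecAll.∷_) (vectors-all S-all n)))

replicate∈vectors : {A : Set} {S : List A} {x : A} → x ∈ S → ∀ n → replicate n x ∈ vectors S n
replicate∈vectors x∈S zero    = here refl
replicate∈vectors x∈S (suc n) = ∈-prefixed (λ _ → vectors _ n) (∈-map⁺ (_∷ᵛ []ᵛ) x∈S) (replicate∈vectors x∈S n)

module Uniform {A : Set} (_≟_ : DecidableEquality A) where

  uniform : {n : ℕ} → Vec A (suc n) → Bool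
  uniform {n} (x ∷ᵛ w) = does (≡-dec _≟_ w (replicate n x))

  uniform-lookup : {n : ℕ} (u : Vec A (suc n)) → uniform u ≡ true → ∀ i → Vec.lookup u i ≡ Vec.head u
  uniform-lookup (x ∷ᵛ w) _ Fin.zero = refl
  uniform-lookup {n} (x ∷ᵛ w) uniform-u (Fin.suc i) with ≡-dec _≟_ w (replicate n x)
  ... | yes refl = lookup-replicate i x

  count-uniform : {S : List A} → Unique S → ∀ n → count uniform (vectors S (suc n)) ≡ length S
  count-uniform {S} S-unique n = begin
      count uniform (vectors S (suc n))
    ≡⟨ count-prefixed uniform (map (_∷ᵛ []ᵛ) S) (λ _ → vectors S n) ⟩
      sum (map (λ u → count (λ w → uniform (u ++ᵛ w)) (vectors S n)) (map (_∷ᵛ []ᵛ) S))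
    ≡⟨ sum-constant _ 1 (AllP.map⁺ (All.tabulate (λ x∈S →
         count-≡-member (≡-dec _≟_) (vectors-unique S-unique n) (replicate∈vectors x∈S n)))) ⟩
      length (map (_∷ᵛ []ᵛ) S) * 1
    ≡⟨ trans (*-identityʳ _) (length-map (_∷ᵛ []ᵛ) S) ⟩
      length S ∎
    where open ≡-Reasoning

subsetsOfSize : (k j : ℕ) → List (Subset k)
subsetsOfSize zero    zero    = [ []ᵛ ]
subsetsOfSize zero    (suc j) = []
subsetsOfSize (suc k) zero    = map (false ∷ᵛ_) (subsetsOfSize k zero)
subsetsOfSize (suc k) (suc j) =
  map (true ∷ᵛ_) (subsetsOfSize k j) ++ map (false ∷ᵛ_) (subsetsOfSize k (suc j))

length-subsetsOfSize : ∀ k j → length (subsetsOfSize k j) ≡ k C j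
length-subsetsOfSize zero    zero    = refl
length-subsetsOfSize zero    (suc j) = refl
length-subsetsOfSize (suc k) zero    =
  trans (length-map _ (subsetsOfSize k zero)) (length-subsetsOfSize k zero)
length-subsetsOfSize (suc k) (suc j) = begin
    length (map (true ∷ᵛ_) (subsetsOfSize k j) ++ map (false ∷ᵛ_) (subsetsOfSize k (suc j)))
  ≡⟨ length-++ (map (true ∷ᵛ_) (subsetsOfSize k j)) ⟩
    length (map (true ∷ᵛ_) (subsetsOfSize k j)) + length (map (false ∷ᵛ_) (subsetsOfSize k (suc j)))
  ≡⟨ cong₂ _+_ (trans (length-map _ (subsetsOfSize k j)) (length-subsetsOfSize k j))
               (trans (length-map _ (subsetsOfSize k (suc j))) (length-subsetsOfSize k (suc j))) ⟩
    k C j + k C suc j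
  ≡⟨ nCk+nC[k+1]≡[n+1]C[k+1] k j ⟩
    suc k C suc j ∎
  where open ≡-Reasoning

subsetsOfSize-size : ∀ k j → All (λ X → ∣ X ∣ ≡ j) (subsetsOfSize k j)
subsetsOfSize-size zero    zero    = refl ∷ []
subsetsOfSize-size zero    (suc j) = []
subsetsOfSize-size (suc k) zero    = AllP.map⁺ (subsetsOfSize-size k zero)
subsetsOfSize-size (suc k) (suc j) =
  AllP.++⁺ (AllP.map⁺ (All.map (cong suc) (subsetsOfSize-size k j)))
           (AllP.map⁺ (subsetsOfSize-size k (suc j)))

subsetsOfSize-unique : ∀ k j → Unique (subsetsOfSize k j)
subsetsOfSize-unique zero    zero    = [] ∷ []
subsetsOfSize-unique zero    (suc j) = []
subsetsOfSize-unique (suc k) zero    = UniqueP.map⁺ ∷-injectiveʳ (subsetsOfSize-unique k zero)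
subsetsOfSize-unique (suc k) (suc j) =
  UniqueP.++⁺ (UniqueP.map⁺ ∷-injectiveʳ (subsetsOfSize-unique k j))
              (UniqueP.map⁺ ∷-injectiveʳ (subsetsOfSize-unique k (suc j)))
              disjoint
  where
  disjoint : ∀ {X} → ¬ (X ∈ map (true ∷ᵛ_) (subsetsOfSize k j) × X ∈ map (false ∷ᵛ_) (subsetsOfSize k (suc j)))
  disjoint (X∈ , X∈′) with ∈-map⁻ _ X∈ | ∈-map⁻ _ X∈′
  ... | _ , _ , refl | _ , _ , ()

subsetsOfSize-nonempty : ∀ k j → j ≤ k → 1 ≤ length (subsetsOfSize k j)
subsetsOfSize-nonempty zero    zero    _ = s≤s z≤n
subsetsOfSize-nonempty (suc k) zero    _ =
  subst (1 ≤_) (sym (length-map _ (subsetsOfSize k zero))) (subsetsOfSize-nonempty k zero z≤n)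
subsetsOfSize-nonempty (suc k) (suc j) (s≤s j≤k) =
  subst (1 ≤_) (sym (length-++ (map (true ∷ᵛ_) (subsetsOfSize k j))))
    (≤-trans (subst (1 ≤_) (sym (length-map _ (subsetsOfSize k j))) (subsetsOfSize-nonempty k j j≤k))
             (m≤m+n _ _))

C≤2^ : ∀ k j → k C j ≤ 2 ^ k
C≤2^ zero    zero    = ≤-refl
C≤2^ zero    (suc j) = z≤n
C≤2^ (suc k) zero    = m^n>0 2 (suc k)
C≤2^ (suc k) (suc j) = begin
    suc k C suc j
  ≡⟨ sym (nCk+nC[k+1]≡[n+1]C[k+1] k j) ⟩
    k C j + k C suc j
  ≤⟨ +-mono-≤ (C≤2^ k j) (C≤2^ k (suc j)) ⟩
    2 ^ k + 2 ^ k
  ≡⟨ cong (2 ^ k +_) (sym (+-identityʳ (2 ^ k))) ⟩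
    2 ^ suc k ∎
  where open ≤-Reasoning

total : {n : ℕ} → (Fin n → ℕ) → ℕ
total f = sum (List.tabulate f)

total-cong : {n : ℕ} {f g : Fin n → ℕ} → (∀ i → f i ≡ g i) → total f ≡ total g
total-cong {zero}  f≡g = refl
total-cong {suc n} f≡g = cong₂ _+_ (f≡g Fin.zero) (total-cong (λ i → f≡g (Fin.suc i)))

total-zero : {n : ℕ} {f : Fin n → ℕ} → (∀ i → f i ≡ 0) → total f ≡ 0
total-zero {zero}  f≡0 = refl
total-zero {suc n} f≡0 = cong₂ _+_ (f≡0 Fin.zero) (total-zero (λ i → f≡0 (Fin.suc i)))

total-const : ∀ n c → total {n} (λ _ → c) ≡ n * c
total-const zero    c = refl
total-const (suc n) c = cong (c +_) (total-const n c)

total-+ : (a : ℕ) {b : ℕ} (f : Fin (a + b) → ℕ) →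
          total f ≡ total (λ i → f (i ↑ˡ b)) + total (λ j → f (a ↑ʳ j))
total-+ zero    f = refl
total-+ (suc a) f = trans (cong (f Fin.zero +_) (total-+ a (λ i → f (Fin.suc i)))) (sym (+-assoc (f Fin.zero) _ _))

total-others : ∀ d (v : Fin (suc d)) → total (λ u → if not (does (v ≟ᶠ u)) then 1 else 0) ≡ d
total-others zero    Fin.zero    = refl
total-others (suc d) Fin.zero    = cong suc (trans (total-const d 1) (*-identityʳ d))
total-others (suc d) (Fin.suc v) = cong suc (total-others d v)

edgeIndicator : {n : ℕ} → Graph n → Fin n → Fin n → ℕ
edgeIndicator G v u = if adj G v u then 1 else 0

degree≡total : {n : ℕ} (G : Graph n) (v : Fin n) → degree G v ≡ total (edgeIndicator G v)
degree≡total G v = cong sum (map-tabulate (λ u → u) (edgeIndicator G v))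

emptyGraph : (n : ℕ) → Graph n
emptyGraph n = record { adj = λ _ _ → false ; sym = λ _ _ → refl ; irref = λ _ → refl }

completeGraph : (n : ℕ) → Graph n
completeGraph n = record
  { adj   = λ u v → not (does (u ≟ᶠ v))
  ; sym   = λ u v → cong not (does-sym u v)
  ; irref = irrefl
  }
  where
  does-sym : (u v : Fin n) → does (u ≟ᶠ v) ≡ does (v ≟ᶠ u)
  does-sym u v with u ≟ᶠ v | v ≟ᶠ u
  ... | yes _   | yes _   = refl
  ... | yes u≡v | no  v≢u = ⊥-elim (v≢u (sym u≡v))
  ... | no  u≢v | yes v≡u = ⊥-elim (u≢v (sym v≡u))
  ... | no  _   | no  _   = refl
  irrefl : (v : Fin n) → not (does (v ≟ᶠ v)) ≡ false
  irrefl v with v ≟ᶠ v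
  ... | yes _   = refl
  ... | no  v≢v = ⊥-elim (v≢v refl)

degree-emptyGraph : ∀ n v → degree (emptyGraph n) v ≡ 0
degree-emptyGraph n v = trans (degree≡total (emptyGraph n) v) (total-zero {n} (λ _ → refl))

degree-completeGraph : ∀ d v → degree (completeGraph (suc d)) v ≡ d
degree-completeGraph d v = trans (degree≡total (completeGraph (suc d)) v) (total-others d v)

module _ {a b : ℕ} (G : Graph a) (H : Graph b) where

  sumAdj : Fin a ⊎ Fin b → Fin a ⊎ Fin b → Bool
  sumAdj (inj₁ i) (inj₁ j) = adj G i j
  sumAdj (inj₂ i) (inj₂ j) = adj H i j
  sumAdj _        _        = false

  sumAdj-sym : ∀ x y → sumAdj x y ≡ sumAdj y x
  sumAdj-sym (inj₁ i) (inj₁ j) = Graph.sym G i j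
  sumAdj-sym (inj₁ i) (inj₂ j) = refl
  sumAdj-sym (inj₂ i) (inj₁ j) = refl
  sumAdj-sym (inj₂ i) (inj₂ j) = Graph.sym H i j

  sumAdj-irrefl : ∀ x → sumAdj x x ≡ false
  sumAdj-irrefl (inj₁ i) = irref G i
  sumAdj-irrefl (inj₂ j) = irref H j

  infixr 5 _⊕_
  _⊕_ : Graph (a + b)
  _⊕_ = record
    { adj   = λ u v → sumAdj (splitAt a u) (splitAt a v)
    ; sym   = λ u v → sumAdj-sym (splitAt a u) (splitAt a v)
    ; irref = λ v → sumAdj-irrefl (splitAt a v)
    }

  adj-⊕ˡˡ : ∀ i j → adj _⊕_ (i ↑ˡ b) (j ↑ˡ b) ≡ adj G i j
  adj-⊕ˡˡ i j rewrite splitAt-↑ˡ a i b | splitAt-↑ˡ a j b = refl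

  adj-⊕ˡʳ : ∀ i j → adj _⊕_ (i ↑ˡ b) (a ↑ʳ j) ≡ false
  adj-⊕ˡʳ i j rewrite splitAt-↑ˡ a i b | splitAt-↑ʳ a b j = refl

  adj-⊕ʳˡ : ∀ i j → adj _⊕_ (a ↑ʳ i) (j ↑ˡ b) ≡ false
  adj-⊕ʳˡ i j rewrite splitAt-↑ʳ a b i | splitAt-↑ˡ a j b = refl

  adj-⊕ʳʳ : ∀ i j → adj _⊕_ (a ↑ʳ i) (a ↑ʳ j) ≡ adj H i j
  adj-⊕ʳʳ i j rewrite splitAt-↑ʳ a b i | splitAt-↑ʳ a b j = refl

  degree-⊕ˡ : ∀ i → degree _⊕_ (i ↑ˡ b) ≡ degree G i
  degree-⊕ˡ i = begin
      degree _⊕_ (i ↑ˡ b)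
    ≡⟨ degree≡total _⊕_ (i ↑ˡ b) ⟩
      total (edgeIndicator _⊕_ (i ↑ˡ b))
    ≡⟨ total-+ a (edgeIndicator _⊕_ (i ↑ˡ b)) ⟩
      total (λ j → edgeIndicator _⊕_ (i ↑ˡ b) (j ↑ˡ b)) + total (λ j → edgeIndicator _⊕_ (i ↑ˡ b) (a ↑ʳ j))
    ≡⟨ cong₂ _+_ (total-cong (λ j → cong (λ e → if e then 1 else 0) (adj-⊕ˡˡ i j)))
                 (total-zero (λ j → cong (λ e → if e then 1 else 0) (adj-⊕ˡʳ i j))) ⟩
      total (edgeIndicator G i) + 0
    ≡⟨ trans (+-identityʳ _) (sym (degree≡total G i)) ⟩
      degree G i ∎
    where open ≡-Reasoning

  degree-⊕ʳ : ∀ j → degree _⊕_ (a ↑ʳ j) ≡ degree H j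
  degree-⊕ʳ j = begin
      degree _⊕_ (a ↑ʳ j)
    ≡⟨ degree≡total _⊕_ (a ↑ʳ j) ⟩
      total (edgeIndicator _⊕_ (a ↑ʳ j))
    ≡⟨ total-+ a (edgeIndicator _⊕_ (a ↑ʳ j)) ⟩
      total (λ i → edgeIndicator _⊕_ (a ↑ʳ j) (i ↑ˡ b)) + total (λ i → edgeIndicator _⊕_ (a ↑ʳ j) (a ↑ʳ i))
    ≡⟨ cong₂ _+_ (total-zero (λ i → cong (λ e → if e then 1 else 0) (adj-⊕ʳˡ j i)))
                 (total-cong (λ i → cong (λ e → if e then 1 else 0) (adj-⊕ʳʳ j i))) ⟩
      total (edgeIndicator H j)
    ≡⟨ sym (degree≡total H j) ⟩
      degree H j ∎
    where open ≡-Reasoning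

  degree-⊕-≤ : ∀ {d} → (∀ i → degree G i ≤ d) → (∀ j → degree H j ≤ d) → ∀ v → degree _⊕_ v ≤ d
  degree-⊕-≤ {d} G≤ H≤ v = by-part (splitAt a v) refl
    where
    by-part : ∀ x → splitAt a v ≡ x → degree _⊕_ v ≤ d
    by-part (inj₁ i) v≡ = subst (λ v → degree _⊕_ v ≤ d) (splitAt⁻¹-↑ˡ v≡) (subst (_≤ d) (sym (degree-⊕ˡ i)) (G≤ i))
    by-part (inj₂ j) v≡ = subst (λ v → degree _⊕_ v ≤ d) (splitAt⁻¹-↑ʳ v≡) (subst (_≤ d) (sym (degree-⊕ʳ j)) (H≤ j))

  colourable-⊕ˡ : ∀ {k} (L₁ : ListAssignment a k) (L₂ : ListAssignment b k) →
                  LColorable _⊕_ (L₁ ++ᵛ L₂) → LColorable G L₁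
  colourable-⊕ˡ L₁ L₂ (c , c∈L , proper) =
      (λ i → c (i ↑ˡ b))
    , (λ i → subst (c (i ↑ˡ b) ∈ˢ_) (lookup-++ˡ L₁ L₂ i) (c∈L (i ↑ˡ b)))
    , (λ i j i~j → proper (i ↑ˡ b) (j ↑ˡ b) (trans (adj-⊕ˡˡ i j) i~j))

  colourable-⊕ʳ : ∀ {k} (L₁ : ListAssignment a k) (L₂ : ListAssignment b k) →
                  LColorable _⊕_ (L₁ ++ᵛ L₂) → LColorable H L₂
  colourable-⊕ʳ L₁ L₂ (c , c∈L , proper) =
      (λ j → c (a ↑ʳ j))
    , (λ j → subst (c (a ↑ʳ j) ∈ˢ_) (lookup-++ʳ L₁ L₂ j) (c∈L (a ↑ʳ j)))
    , (λ i j i~j → proper (a ↑ʳ i) (a ↑ʳ j) (trans (adj-⊕ʳʳ i j) i~j))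

distinct-in-subset : ∀ j {k} (X : Subset k) (f : Fin j → Fin k) →
                     (∀ i → f i ∈ˢ X) → (∀ i i′ → i ≢ i′ → f i ≢ f i′) → j ≤ ∣ X ∣
distinct-in-subset zero    X f f∈X f-distinct = z≤n
distinct-in-subset (suc j) X f f∈X f-distinct =
  <-≤-trans (s≤s (distinct-in-subset j (X - f Fin.zero) (λ i → f (Fin.suc i))
                   (λ i → x∈p∧x≢y⇒x∈p-y (f∈X (Fin.suc i)) (f-distinct (Fin.suc i) Fin.zero (λ ())))
                   (λ i i′ i≢i′ → f-distinct (Fin.suc i) (Fin.suc i′) (λ e → i≢i′ (Fin-suc-injective e)))))
            (x∈p⇒∣p-x∣<∣p∣ (f∈X Fin.zero))

completeGraph-uncolourable : ∀ {r k} (L : ListAssignment r k) (X : Subset k) →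
                             (∀ i → Vec.lookup L i ≡ X) → ∣ X ∣ < r → ¬ LColorable (completeGraph r) L
completeGraph-uncolourable {r} L X L≡X ∣X∣<r (c , c∈L , proper) =
  <⇒≱ ∣X∣<r (distinct-in-subset r X c (λ i → subst (c i ∈ˢ_) (L≡X i) (c∈L i)) c-distinct)
  where
  c-distinct : ∀ i i′ → i ≢ i′ → c i ≢ c i′
  c-distinct i i′ i≢i′ = proper i i′ (distinct-adjacent i i′ i≢i′)
    where
    distinct-adjacent : ∀ i i′ → i ≢ i′ → not (does (i ≟ᶠ i′)) ≡ true
    distinct-adjacent i i′ i≢i′ with i ≟ᶠ i′
    ... | yes i≡i′ = ⊥-elim (i≢i′ i≡i′)
    ... | no  _    = refl

cliqueVertices : (d K s : ℕ) → ℕ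
cliqueVertices d zero    s = s
cliqueVertices d (suc K) s = suc d + cliqueVertices d K s

cliqueUnion : (d K s : ℕ) → Graph (cliqueVertices d K s)
cliqueUnion d zero    s = emptyGraph s
cliqueUnion d (suc K) s = completeGraph (suc d) ⊕ cliqueUnion d K s

-- The vertex count is s + K (d + 1), the shape of division with remainder.
cliqueVertices≡ : ∀ d K s → cliqueVertices d K s ≡ s + K * suc d
cliqueVertices≡ d zero    s = sym (+-identityʳ s)
cliqueVertices≡ d (suc K) s = begin
    suc d + cliqueVertices d K s
  ≡⟨ cong (suc d +_) (cliqueVertices≡ d K s) ⟩
    suc d + (s + K * suc d)
  ≡⟨ sym (+-assoc (suc d) s _) ⟩
    (suc d + s) + K * suc d
  ≡⟨ cong (_+ K * suc d) (+-comm (suc d) s) ⟩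
    (s + suc d) + K * suc d
  ≡⟨ +-assoc s (suc d) _ ⟩
    s + suc K * suc d ∎
  where open ≡-Reasoning

cliqueUnion-degree-≤ : ∀ d K s v → degree (cliqueUnion d K s) v ≤ d
cliqueUnion-degree-≤ d zero    s v = ≤-trans (≤-reflexive (degree-emptyGraph s v)) z≤n
cliqueUnion-degree-≤ d (suc K) s   =
  degree-⊕-≤ (completeGraph (suc d)) (cliqueUnion d K s)
    (λ i → ≤-reflexive (degree-completeGraph d i)) (cliqueUnion-degree-≤ d K s)

cliqueUnion-maxDegree : ∀ d K s → MaxDegree (cliqueUnion d (suc K) s) d
cliqueUnion-maxDegree d K s =
    cliqueUnion-degree-≤ d (suc K) s
  , Fin.zero ↑ˡ cliqueVertices d K s
  , trans (degree-⊕ˡ (completeGraph (suc d)) (cliqueUnion d K s) Fin.zero) (degree-completeGraph d Fin.zero)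

-- Bernoulli's inequality  (1 - x)^K (1 + K x) ≤ 1  for x = E / (E + F),
-- with denominators cleared.
bernoulli : ∀ E F K → F ^ K * ((E + F) + K * E) ≤ (E + F) ^ suc K
bernoulli E F zero = ≤-reflexive (trans (*-identityˡ _) (trans (+-identityʳ _) (sym (*-identityʳ _))))
bernoulli E F (suc K) = begin
    F ^ suc K * (A + suc K * E)
  ≡⟨ regroup F (F ^ K) A (E + K * E) ⟩
    F ^ K * (F * (A + (E + K * E)))
  ≤⟨ *-monoʳ-≤ (F ^ K) (subst (F * (A + (E + K * E)) ≤_) (sym (square-split E F K)) (m≤m+n _ _)) ⟩
    F ^ K * (A * (A + K * E))
  ≡⟨ exchange (F ^ K) A (A + K * E) ⟩
    A * (F ^ K * (A + K * E))
  ≤⟨ *-monoʳ-≤ A (bernoulli E F K) ⟩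
    A ^ suc (suc K) ∎
  where
  open ≤-Reasoning
  A : ℕ
  A = E + F
  regroup : ∀ f p a b → f * p * (a + b) ≡ p * (f * (a + b))
  regroup = solve-∀
  square-split : ∀ E F K → (E + F) * ((E + F) + K * E) ≡ F * ((E + F) + (E + K * E)) + E * (E + K * E)
  square-split = solve-∀
  exchange : ∀ p a b → p * (a * b) ≡ a * (p * b)
  exchange = solve-∀

bernoulli-fraction : ∀ E F K m → 1 ≤ E + F → m * (E + F) ≤ K * E → suc m * F ^ K ≤ (E + F) ^ K
bernoulli-fraction E F K m 1≤A mA≤KE = *-cancelˡ-≤ (E + F) {{>-nonZero 1≤A}} (begin
    (E + F) * (suc m * F ^ K)
  ≡⟨ rearrange (E + F) m (F ^ K) ⟩
    F ^ K * ((E + F) + m * (E + F))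
  ≤⟨ *-monoʳ-≤ (F ^ K) (+-monoʳ-≤ (E + F) mA≤KE) ⟩
    F ^ K * ((E + F) + K * E)
  ≤⟨ bernoulli E F K ⟩
    (E + F) * (E + F) ^ K ∎)
  where
  open ≤-Reasoning
  rearrange : ∀ a m p → a * (suc m * p) ≡ p * (a + m * a)
  rearrange = solve-∀

complement-fraction : ∀ m B G T → B + G ≡ T → suc m * G ≤ T → m * T ≤ suc m * B
complement-fraction m B G T B+G≡T [m+1]G≤T = +-cancelʳ-≤ (suc m * G) (m * T) (suc m * B) (begin
    m * T + suc m * G
  ≤⟨ +-monoʳ-≤ (m * T) [m+1]G≤T ⟩
    m * T + T
  ≡⟨ +-comm (m * T) T ⟩
    suc m * T
  ≡⟨ cong (suc m *_) (sym B+G≡T) ⟩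
    suc m * (B + G)
  ≡⟨ *-distribˡ-+ (suc m) B G ⟩
    suc m * B + suc m * G ∎)
  where open ≤-Reasoning

-- An assignment is "bad" on the union of K cliques of size d + 1
-- as soon as some clique receives one and the same list on all its vertices:
-- d colours cannot properly colour d + 1 pairwise adjacent vertices.
module BadAssignments {k d : ℕ} (S : List (Subset k)) (S-unique : Unique S)
                      (S-size : All (λ X → ∣ X ∣ ≡ d) S) where

  open Uniform {Subset k} (≡-dec Bool._≟_)

  HasSizes : ∀ {n} → ListAssignment n k → Set
  HasSizes = VecAll.All (λ X → ∣ X ∣ ≡ d)

  bad : ∀ K s → List (ListAssignment (cliqueVertices d K s) k)
  continuations : ∀ K s → ListAssignment (suc d) k → List (ListAssignment (cliqueVertices d K s) k)

  bad zero    s = []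
  bad (suc K) s = prefixed (vectors S (suc d)) (continuations K s)

  continuations K s u = if uniform u then vectors S (cliqueVertices d K s) else bad K s

  bad-unique : ∀ K s → Unique (bad K s)
  bad-unique zero    s = []
  bad-unique (suc K) s =
    prefixed-unique (continuations K s) (vectors-unique S-unique (suc d)) continuations-unique
    where
    continuations-unique : ∀ u → Unique (continuations K s u)
    continuations-unique u with uniform u
    ... | true  = vectors-unique S-unique (cliqueVertices d K s)
    ... | false = bad-unique K s

  bad-uncolourable : ∀ K s → All (λ L → HasSizes L × ¬ LColorable (cliqueUnion d K s) L) (bad K s)
  bad-uncolourable zero    s = []
  bad-uncolourable (suc K) s =
    prefixed-all (continuations K s) (λ u∈ → extend _ (All.lookup (vectors-all S-size (suc d)) u∈))
    where
    G₁ : Graph (suc d)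
    G₁ = completeGraph (suc d)
    G₂ : Graph (cliqueVertices d K s)
    G₂ = cliqueUnion d K s
    extend : ∀ u → HasSizes u →
             All (λ w → HasSizes (u ++ᵛ w) × ¬ LColorable (G₁ ⊕ G₂) (u ++ᵛ w)) (continuations K s u)
    extend u u-sizes with uniform u in u-uniform
    ... | true  = All.map (λ {w} w-sizes →
                      VecAllP.++⁺ u-sizes w-sizes
                    , λ col → completeGraph-uncolourable u (Vec.head u) (uniform-lookup u u-uniform)
                                (≤-reflexive (cong suc (head-size u-sizes))) (colourable-⊕ˡ G₁ G₂ u w col))
                    (vectors-all S-size (cliqueVertices d K s))
      where
      head-size : ∀ {u : ListAssignment (suc d) k} → HasSizes u → ∣ Vec.head u ∣ ≡ d
      head-size (size VecAll.∷ _) = size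
    ... | false = All.map (λ {w} (w-sizes , w-bad) →
                      VecAllP.++⁺ u-sizes w-sizes
                    , λ col → w-bad (colourable-⊕ʳ G₁ G₂ u w col))
                    (bad-uncolourable K s)

  c E F : ℕ
  c = length S
  E = count uniform (vectors S (suc d))
  F = count (λ u → not (uniform u)) (vectors S (suc d))

  E≡c : E ≡ c
  E≡c = count-uniform S-unique d

  E+F≡c^[d+1] : E + F ≡ c ^ suc d
  E+F≡c^[d+1] = trans (count+count-not uniform (vectors S (suc d))) (length-vectors S (suc d))

  length-bad : ∀ K s → length (bad (suc K) s) ≡ E * c ^ cliqueVertices d K s + F * length (bad K s)
  length-bad K s = begin
      length (bad (suc K) s)
    ≡⟨ length-prefixed (vectors S (suc d)) (continuations K s) ⟩
      sum (map (λ u → length (continuations K s u)) (vectors S (suc d)))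
    ≡⟨ cong sum (map-cong length-continuations (vectors S (suc d))) ⟩
      sum (map (λ u → if uniform u then c ^ cliqueVertices d K s else length (bad K s)) (vectors S (suc d)))
    ≡⟨ sum-if uniform _ _ (vectors S (suc d)) ⟩
      E * c ^ cliqueVertices d K s + F * length (bad K s) ∎
    where
    open ≡-Reasoning
    length-continuations : ∀ u → length (continuations K s u)
                                 ≡ (if uniform u then c ^ cliqueVertices d K s else length (bad K s))
    length-continuations u with uniform u
    ... | true  = length-vectors S (cliqueVertices d K s)
    ... | false = refl

  -- The complement of the bad list consists of the F^K c^s assignments
  -- with a non-uniform block on every clique.
  bad+good : ∀ K s → length (bad K s) + F ^ K * c ^ s ≡ c ^ cliqueVertices d K s
  bad+good zero    s = *-identityˡ _
  bad+good (suc K) s = begin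
      length (bad (suc K) s) + F ^ suc K * c ^ s
    ≡⟨ cong (_+ F ^ suc K * c ^ s) (length-bad K s) ⟩
      (E * c ^ n + F * length (bad K s)) + F * F ^ K * c ^ s
    ≡⟨ regroup E (c ^ n) F (length (bad K s)) (F ^ K) (c ^ s) ⟩
      E * c ^ n + F * (length (bad K s) + F ^ K * c ^ s)
    ≡⟨ cong (λ x → E * c ^ n + F * x) (bad+good K s) ⟩
      E * c ^ n + F * c ^ n
    ≡⟨ sym (*-distribʳ-+ (c ^ n) E F) ⟩
      (E + F) * c ^ n
    ≡⟨ cong (_* c ^ n) E+F≡c^[d+1] ⟩
      c ^ suc d * c ^ n
    ≡⟨ sym (^-distribˡ-+-* c (suc d) n) ⟩
      c ^ cliqueVertices d (suc K) s ∎
    where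
    open ≡-Reasoning
    n : ℕ
    n = cliqueVertices d K s
    regroup : ∀ e t f b p q → (e * t + f * b) + f * p * q ≡ e * t + f * (b + p * q)
    regroup = solve-∀

  all+good : ∀ K s → (E + F) ^ K * c ^ s ≡ c ^ cliqueVertices d K s
  all+good zero    s = *-identityˡ _
  all+good (suc K) s = begin
      (E + F) * (E + F) ^ K * c ^ s
    ≡⟨ *-assoc (E + F) _ _ ⟩
      (E + F) * ((E + F) ^ K * c ^ s)
    ≡⟨ cong₂ _*_ E+F≡c^[d+1] (all+good K s) ⟩
      c ^ suc d * c ^ cliqueVertices d K s
    ≡⟨ sym (^-distribˡ-+-* c (suc d) _) ⟩
      c ^ cliqueVertices d (suc K) s ∎
    where open ≡-Reasoning

  bad-fraction : ∀ K s m → 1 ≤ c → m * c ^ d ≤ K → m * c ^ cliqueVertices d K s ≤ suc m * length (bad K s)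
  bad-fraction K s m 1≤c mc^d≤K =
    complement-fraction m (length (bad K s)) (F ^ K * c ^ s) (c ^ cliqueVertices d K s) (bad+good K s) (begin
        suc m * (F ^ K * c ^ s)
      ≡⟨ sym (*-assoc (suc m) (F ^ K) (c ^ s)) ⟩
        suc m * F ^ K * c ^ s
      ≤⟨ *-monoˡ-≤ (c ^ s) (bernoulli-fraction E F K m 1≤E+F enough-cliques) ⟩
        (E + F) ^ K * c ^ s
      ≡⟨ all+good K s ⟩
        c ^ cliqueVertices d K s ∎)
    where
    open ≤-Reasoning
    1≤E+F : 1 ≤ E + F
    1≤E+F = subst (1 ≤_) (sym E+F≡c^[d+1]) (m^n>0 c {{>-nonZero 1≤c}} (suc d))
    enough-cliques : m * (E + F) ≤ K * E
    enough-cliques = begin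
        m * (E + F)
      ≡⟨ cong (m *_) E+F≡c^[d+1] ⟩
        m * (c * c ^ d)
      ≡⟨ x∙yz≡y∙xz m c (c ^ d) ⟩
        c * (m * c ^ d)
      ≤⟨ *-monoʳ-≤ c mc^d≤K ⟩
        c * K
      ≡⟨ trans (*-comm c K) (cong (K *_) (sym E≡c)) ⟩
        K * E ∎
      where
      x∙yz≡y∙xz : ∀ x y z → x * (y * z) ≡ y * (x * z)
      x∙yz≡y∙xz = solve-∀

  bad-probability : ∀ K s m → length S ≡ k C d → 1 ≤ c → m * c ^ d ≤ K →
                    BadProbAtLeast (cliqueUnion d K s) k d m
  bad-probability K s m c≡kCd 1≤c mc^d≤K =
      bad K s
    , bad-unique K s
    , All.map (λ (sizes , uncolourable) → VecAllP.lookup⁺ sizes , uncolourable) (bad-uncolourable K s)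
    , subst (λ x → m * x ^ cliqueVertices d K s ≤ suc m * length (bad K s)) c≡kCd (bad-fraction K s m 1≤c mc^d≤K)

expTerm : ℕ → ℕ → ℚᵘ
expTerm k M = ((+ℤ (k ^ M)) ℚᵘ./ (M !)) {{M !≢0}}

fraction≥0 : ∀ a d .{{_ : NonZero d}} → 0ℚᵘ ℚᵘ.≤ ((+ℤ a) ℚᵘ./ d)
fraction≥0 a (suc d) = ℚᵘP.nonNegative⁻¹ ((+ℤ a) ℚᵘ./ suc d)

fraction≤integer : ∀ a d .{{_ : NonZero d}} n → ((+ℤ a) ℚᵘ./ d) ℚᵘ.≤ ((+ℤ n) ℚᵘ./ 1) → a ≤ n * d
fraction≤integer a (suc d) n (*≤* a*1≤n*d) =
  subst (_≤ n * suc d) (*-identityʳ a)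
    (drop‿+≤+ (subst₂ ℤ._≤_ (sym (pos-* a 1)) (sym (pos-* n (suc d))) a*1≤n*d))

expPartial≥0 : ∀ k M → 0ℚᵘ ℚᵘ.≤ expPartial k M
expPartial≥0 k zero    = fraction≥0 1 1
expPartial≥0 k (suc M) = ℚᵘP.+-mono-≤ (expPartial≥0 k M) (fraction≥0 (k ^ suc M) (suc M !) {{suc M !≢0}})

expTerm≤expPartial : ∀ k M → expTerm k M ℚᵘ.≤ expPartial k M
expTerm≤expPartial k zero    = ℚᵘP.≤-refl
expTerm≤expPartial k (suc M) =
  ℚᵘP.p≤q+p (expTerm k (suc M)) (expPartial k M) {{ℚᵘ.nonNegative (expPartial≥0 k M)}}

ExpLe⇒power≤ : ∀ {k n} → ExpLe k n → ∀ M → k ^ M ≤ n * M !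
ExpLe⇒power≤ {k} {n} e^k≤n M =
  fraction≤integer (k ^ M) (M !) {{M !≢0}} n (ℚᵘP.≤-trans (expTerm≤expPartial k M) (e^k≤n M))

*-^ : ∀ a b t → (a * b) ^ t ≡ a ^ t * b ^ t
*-^ a b zero    = refl
*-^ a b (suc t) = trans (cong ((a * b) *_) (*-^ a b t)) ([m*n]*[o*p]≡[m*o]*[n*p] a b (a ^ t) (b ^ t))

suc-factorial≤ : ∀ u → suc u ! ≤ suc u ^ u
suc-factorial≤ zero    = ≤-refl
suc-factorial≤ (suc u) = *-monoʳ-≤ (suc (suc u)) (≤-trans (suc-factorial≤ u) (^-monoˡ-≤ u (n≤1+n (suc u))))

factorial*n≤n^n : ∀ t → t ! * t ≤ t ^ t
factorial*n≤n^n zero    = z≤n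
factorial*n≤n^n (suc u) =
  subst (suc u ! * suc u ≤_) (*-comm (suc u ^ u) (suc u)) (*-monoˡ-≤ (suc u) (suc-factorial≤ u))

-- e^(4t) ≤ n gives 4^t · t ≤ n: compare with the t-th term (4t)^t / t! of the series.
ExpLe⇒4^t*t≤ : ∀ t {n} → ExpLe (4 * t) n → 4 ^ t * t ≤ n
ExpLe⇒4^t*t≤ t {n} e^4t≤n = *-cancelˡ-≤ (t !) {{t !≢0}} (begin
    t ! * (4 ^ t * t)
  ≡⟨ x∙yz≡y∙xz (t !) (4 ^ t) t ⟩
    4 ^ t * (t ! * t)
  ≤⟨ *-monoʳ-≤ (4 ^ t) (factorial*n≤n^n t) ⟩
    4 ^ t * t ^ t
  ≡⟨ sym (*-^ 4 t t) ⟩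
    (4 * t) ^ t
  ≤⟨ ExpLe⇒power≤ e^4t≤n t ⟩
    n * t !
  ≡⟨ *-comm n (t !) ⟩
    t ! * n ∎)
  where
  open ≤-Reasoning
  x∙yz≡y∙xz : ∀ x y z → x * (y * z) ≡ y * (x * z)
  x∙yz≡y∙xz = solve-∀

ExpLe⇒suc≤ : ∀ d {n} → 1 ≤ n → ExpLe (4 * (d * d)) n → suc d ≤ n
ExpLe⇒suc≤ zero    1≤n _         = 1≤n
ExpLe⇒suc≤ (suc d) {n} _ e^4d²≤n = begin
    suc (suc d)
  ≤⟨ s≤s (m≤n+m (suc d) d) ⟩
    suc d + suc d
  ≤⟨ +-monoʳ-≤ (suc d) (m≤m+n (suc d) _) ⟩
    4 * suc d
  ≤⟨ *-monoʳ-≤ 4 (m≤m*n (suc d) (suc d)) ⟩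
    4 * (suc d * suc d)
  ≡⟨ sym (*-identityʳ _) ⟩
    (4 * (suc d * suc d)) ^ 1
  ≤⟨ ExpLe⇒power≤ e^4d²≤n 1 ⟩
    n * 1
  ≡⟨ *-identityʳ n ⟩
    n ∎
  where open ≤-Reasoning

-- Beyond this threshold, e^(4d²) ≤ n forces n ≥ m 4^(d²) (d + 1): either d is
-- large and the exponential wins, or d ≤ m and the threshold itself suffices.
threshold : ℕ → ℕ
threshold m = suc (m * 4 ^ (m * m) * suc m)

enough-vertices : ∀ m d {n} → threshold m ≤ n → ExpLe (4 * (d * d)) n → m * 4 ^ (d * d) * suc d ≤ n
enough-vertices m d {n} N≤n e^4d²≤n with m <? d
... | yes m<d = begin
    m * 4 ^ (d * d) * suc d
  ≡⟨ rearrange m (4 ^ (d * d)) (suc d) ⟩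
    4 ^ (d * d) * (m * suc d)
  ≤⟨ *-monoʳ-≤ (4 ^ (d * d)) m[d+1]≤d² ⟩
    4 ^ (d * d) * (d * d)
  ≤⟨ ExpLe⇒4^t*t≤ (d * d) e^4d²≤n ⟩
    n ∎
  where
  open ≤-Reasoning
  rearrange : ∀ x y z → x * y * z ≡ y * (x * z)
  rearrange = solve-∀
  m[d+1]≤d² : m * suc d ≤ d * d
  m[d+1]≤d² = begin
      m * suc d
    ≡⟨ *-suc m d ⟩
      m + m * d
    ≤⟨ +-monoˡ-≤ (m * d) (<⇒≤ m<d) ⟩
      suc m * d
    ≤⟨ *-monoˡ-≤ d m<d ⟩
      d * d ∎
... | no m≮d = ≤-trans (≤-trans small (n≤1+n _)) N≤n
  where
  d≤m : d ≤ m
  d≤m = ≮⇒≥ m≮d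
  small : m * 4 ^ (d * d) * suc d ≤ m * 4 ^ (m * m) * suc m
  small = *-mono-≤ (*-monoʳ-≤ m (^-monoʳ-≤ 4 (*-mono-≤ d≤m d≤m))) (s≤s d≤m)

cliqueVertices-divMod : ∀ d n → cliqueVertices d (n / suc d) (n % suc d) ≡ n
cliqueVertices-divMod d n = trans (cliqueVertices≡ d (n / suc d) (n % suc d)) (sym (m≡m%n+[m/n]*n n (suc d)))

cliqueGraph : (d n : ℕ) → Graph n
cliqueGraph d n = subst Graph (cliqueVertices-divMod d n) (cliqueUnion d (n / suc d) (n % suc d))

transport : ∀ {m n} (m≡n : m ≡ n) (P : (n : ℕ) → Graph n → Set) (G : Graph m) → P m G → P n (subst Graph m≡n G)
transport refl P G PG = PG

quotient≥ : ∀ d {n q} → q * suc d ≤ n → q ≤ n / suc d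
quotient≥ d {n} {q} q[d+1]≤n = subst (_≤ n / suc d) (m*n/n≡m q (suc d)) (/-monoˡ-≤ (suc d) q[d+1]≤n)

cliqueGraph-maxDegree : ∀ d n → suc d ≤ n → MaxDegree (cliqueGraph d n) d
cliqueGraph-maxDegree d n d+1≤n =
  transport (cliqueVertices-divMod d n) (λ _ G → MaxDegree G d) _
    (with-a-clique (n / suc d) (quotient≥ d (subst (_≤ n) (sym (*-identityˡ (suc d))) d+1≤n)))
  where
  with-a-clique : ∀ K → 1 ≤ K → MaxDegree (cliqueUnion d K (n % suc d)) d
  with-a-clique (suc K) _ = cliqueUnion-maxDegree d K (n % suc d)

cliqueGraph-bad : ∀ d n m → m * 4 ^ (d * d) ≤ n / suc d → BadProbAtLeast (cliqueGraph d n) (2 * d) d m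
cliqueGraph-bad d n m enough-cliques =
  transport (cliqueVertices-divMod d n) (λ _ G → BadProbAtLeast G (2 * d) d m) _
    (bad-probability (n / suc d) (n % suc d) m (length-subsetsOfSize (2 * d) d)
       (subsetsOfSize-nonempty (2 * d) d (m≤m+n d (d + 0)))
       (≤-trans (*-monoʳ-≤ m c^d≤4^[d²]) enough-cliques))
  where
  open BadAssignments (subsetsOfSize (2 * d) d) (subsetsOfSize-unique (2 * d) d) (subsetsOfSize-size (2 * d) d)
  c^d≤4^[d²] : c ^ d ≤ 4 ^ (d * d)
  c^d≤4^[d²] = begin
      c ^ d
    ≤⟨ ^-monoˡ-≤ d (subst (_≤ 2 ^ (2 * d)) (sym (length-subsetsOfSize (2 * d) d)) (C≤2^ (2 * d) d)) ⟩
      (2 ^ (2 * d)) ^ d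
    ≡⟨ ^-*-assoc 2 (2 * d) d ⟩
      2 ^ (2 * d * d)
    ≡⟨ cong (2 ^_) (*-assoc 2 d d) ⟩
      2 ^ (2 * (d * d))
    ≡⟨ sym (^-*-assoc 2 2 (d * d)) ⟩
      4 ^ (d * d) ∎
    where open ≤-Reasoning

proposition3p2 :
    (Δ : ℕ → ℕ) → (∀ n → 1 ≤ n → IsHalfSqrtLog n (Δ n)) →
    Σ ((n : ℕ) → Graph n) λ G →
      (∀ n → 1 ≤ n → MaxDegree (G n) (Δ n)) ×
      (∀ m → ∃ λ N → ∀ n → N ≤ n → BadProbAtLeast (G n) (2 * Δ n) (Δ n) m)
proposition3p2 Δ Δ-spec = (λ n → cliqueGraph (Δ n) n) , maxDegree , bad-whp
  where
  e^4Δ²≤n : ∀ {n} → 1 ≤ n → ExpLe (4 * (Δ n * Δ n)) n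
  e^4Δ²≤n {n} 1≤n = proj₁ (Δ-spec n 1≤n)

  maxDegree : ∀ n → 1 ≤ n → MaxDegree (cliqueGraph (Δ n) n) (Δ n)
  maxDegree n 1≤n = cliqueGraph-maxDegree (Δ n) n (ExpLe⇒suc≤ (Δ n) 1≤n (e^4Δ²≤n 1≤n))

  bad-whp : ∀ m → ∃ λ N → ∀ n → N ≤ n → BadProbAtLeast (cliqueGraph (Δ n) n) (2 * Δ n) (Δ n) m
  bad-whp m = threshold m , λ n N≤n →
    cliqueGraph-bad (Δ n) n m
      (quotient≥ (Δ n) (enough-vertices m (Δ n) N≤n (e^4Δ²≤n (≤-trans (s≤s z≤n) N≤n))))
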